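{- Let $(P,\lambda)$ be a marked poset with $\min(P)\cup\max(P)\subseteq P^*$ which is strict and irredundant. If the marked chain polytope $\mathcal{C}(P,\lambda)\subseteq\mathbb{R}^{P\setminus P^*}$ is described by inequalities all of the form $x_i\ge 0$ for $i\in P\setminus P^*$ and $\sum_{i\in I}x_i\le 1$ for subsets $I\subseteq P\setminus P^*$, then $\mathcal{C}(P,\lambda)$ is the chain polytope of some poset on the set $P\setminus P^*$.
   Context: A marked poset $(P,\lambda)$ is a finite poset $P$ with an induced subposet $P^*\subseteq P$ of marked elements and an order-preserving map $\lambda:P^*\to\mathbb{R}$; it is strict if $\lambda(a)<\lambda(b)$ whenever $a\prec b$ in $P^*$. "Irredundant" is the paper's undefined term, taken here to mean regular: for each covering relation $p\prec q$ in $P$ and all $a,b\in P^*$ with $a\preceq q$, $p\preceq b$, one has $a=b$ or $\lambda(a)<\lambda(b)$. The marked chain polytope $\mathcal{C}(P,\lambda)$ is the set of $x\in\mathbb{R}_{\ge0}^{P\setminus P^*}$ with $x_{p_1}+\dots+x_{p_k}\le\lambda(b)-\lambda(a)$ for every saturated chain $a\prec p_1\prec\dots\prec p_k\prec b$ in $P$ with $a,b\in P^*$ and $p_1,\dots,p_k\notin P^*$. The chain polytope of a poset $Q$ is $\{x\in\mathbb{R}^Q: x_c\ge0 \text{ for all } c,\ x_{c_1}+\dots+x_{c_k}\le1 \text{ for every chain } c_1\prec\dots\prec c_k \text{ in } Q\}$. -}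

module Defs where

open import Data.Nat using (ℕ; zero; suc)
open import Data.Fin using (Fin; zero; suc)
open import Data.Fin.Subset using (Subset; _∈_; _∉_; _⊆_; ∁)
open import Data.Vec using ([]; _∷_)
open import Data.Bool using (true; false)
open import Data.List using (List; []; _∷_)
open import Data.List.Relation.Unary.All using (All)
open import Data.Product using (Σ; _×_; _,_; ∃)
open import Data.Sum using (_⊎_)
open import Relation.Binary.PropositionalEquality using (_≡_; _≢_)
open import Relation.Binary.Structures using (IsPartialOrder; IsTotalOrder)
open import Algebra.Structures using (IsCommutativeRing)

record OrderedField : Set₁ where
  infixl 6 _+_ _-_
  infixl 7 _*_
  infix 4 _≤_ _<_
  field
    Carrier : Set
    _+_ _*_ : Carrier → Carrier → Carrier
    -_      : Carrier → Carrier
    0# 1#   : Carrier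
    isCommutativeRing : IsCommutativeRing _≡_ _+_ _*_ -_ 0# 1#
    _⁻¹[_]  : (x : Carrier) → x ≢ 0# → Carrier
    ⁻¹-inverse : ∀ x (nz : x ≢ 0#) → x * (x ⁻¹[ nz ]) ≡ 1#
    0≢1     : 0# ≢ 1#
    _≤_     : Carrier → Carrier → Set
    isTotalOrder : IsTotalOrder _≡_ _≤_
    +-mono-≤ : ∀ {x y} z → x ≤ y → x + z ≤ y + z
    *-nonneg : ∀ {x y} → 0# ≤ x → 0# ≤ y → 0# ≤ x * y

  _-_ : Carrier → Carrier → Carrier
  x - y = x + (- y)

  _<_ : Carrier → Carrier → Set
  x < y = (x ≤ y) × (x ≢ y)

-- The finite poset P is Fin n with a partial order _≼_; P* is the subset
-- `marked`; the marking λ is given as a function on all of P of which only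
-- the values on marked elements are ever used.

module _ (F : OrderedField) where
  open OrderedField F

  record MarkedPoset : Set₁ where
    field
      n       : ℕ
      _≼_     : Fin n → Fin n → Set
      isPartialOrder : IsPartialOrder _≡_ _≼_
      marked  : Subset n
      lab     : Fin n → Carrier
      λ-monotone : ∀ {a b} → a ∈ marked → b ∈ marked → a ≼ b → lab a ≤ lab b

    _≺_ : Fin n → Fin n → Set
    p ≺ q = (p ≼ q) × (p ≢ q)

    _⋖_ : Fin n → Fin n → Set
    p ⋖ q = (p ≺ q) × (∀ r → p ≼ r → r ≼ q → (r ≡ p) ⊎ (r ≡ q))

    IsMinimal IsMaximal : Fin n → Set
    IsMinimal p = ∀ q → q ≼ p → q ≡ p
    IsMaximal p = ∀ q → p ≼ q → q ≡ p

    MinMaxMarked : Set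
    MinMaxMarked = (∀ p → IsMinimal p → p ∈ marked) × (∀ p → IsMaximal p → p ∈ marked)

    Strict : Set
    Strict = ∀ {a b} → a ∈ marked → b ∈ marked → a ≺ b → lab a < lab b

    -- "irredundant" = regular
    Regular : Set
    Regular = ∀ {p q} → p ⋖ q → ∀ {a b} → a ∈ marked → b ∈ marked →
              a ≼ q → p ≼ b → (a ≡ b) ⊎ (lab a < lab b)

    data SatChain : Fin n → List (Fin n) → Fin n → Set where
      done : ∀ {a b} → a ⋖ b → SatChain a [] b
      step : ∀ {a p ps b} → a ⋖ p → SatChain p ps b → SatChain a (p ∷ ps) b

  sumList : ∀ {n} → (Fin n → Carrier) → List (Fin n) → Carrier
  sumList x []       = 0#
  sumList x (p ∷ ps) = x p + sumList x ps

  sumSubset : ∀ {n} → Subset n → (Fin n → Carrier) → Carrier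
  sumSubset []          x = 0#
  sumSubset (true ∷ I)  x = x zero + sumSubset I (λ i → x (suc i))
  sumSubset (false ∷ I) x = sumSubset I (λ i → x (suc i))

  -- Points of ℝ^{P∖P*} are represented by functions x : Fin n → Carrier;
  -- every predicate below only reads the coordinates x p with p ∉ P*.

  module _ (M : MarkedPoset) where
    open MarkedPoset M

    InMarkedChainPolytope : (Fin n → Carrier) → Set
    InMarkedChainPolytope x =
      (∀ p → p ∉ marked → 0# ≤ x p) ×
      (∀ a ps b → a ∈ marked → b ∈ marked → All (_∉ marked) ps →
         SatChain a ps b → sumList x ps ≤ lab b - lab a)

    SatisfiesSystem : Subset n → List (Subset n) → (Fin n → Carrier) → Set
    SatisfiesSystem J 𝓘 x =
      (∀ i → i ∈ J → 0# ≤ x i) × All (λ I → sumSubset I x ≤ 1#) 𝓘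

    DescribedBy01 : Set
    DescribedBy01 =
      Σ (Subset n) λ J → Σ (List (Subset n)) λ 𝓘 →
        (J ⊆ ∁ marked) × All (_⊆ ∁ marked) 𝓘 ×
        (∀ x → (InMarkedChainPolytope x → SatisfiesSystem J 𝓘 x) ×
               (SatisfiesSystem J 𝓘 x → InMarkedChainPolytope x))

    -- a partial order _⊑_ on the set P∖P* (relation on Fin n, only its
    -- restriction to unmarked elements matters)
    record PosetOnUnmarked : Set₁ where
      field
        _⊑_      : Fin n → Fin n → Set
        ⊑-refl    : ∀ {c} → c ∉ marked → c ⊑ c
        ⊑-antisym : ∀ {c d} → c ∉ marked → d ∉ marked → c ⊑ d → d ⊑ c → c ≡ d
        ⊑-trans   : ∀ {c d e} → c ∉ marked → d ∉ marked → e ∉ marked →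
                    c ⊑ d → d ⊑ e → c ⊑ e

      data IsChain : List (Fin n) → Set where
        []  : IsChain []
        [_] : ∀ {c} → c ∉ marked → IsChain (c ∷ [])
        _∷_ : ∀ {c d cs} → c ∉ marked → (c ⊑ d) × (c ≢ d) →
              IsChain (d ∷ cs) → IsChain (c ∷ d ∷ cs)

      InChainPolytope : (Fin n → Carrier) → Set
      InChainPolytope x =
        (∀ c → c ∉ marked → 0# ≤ x c) ×
        (∀ cs → IsChain cs → sumList x cs ≤ 1#)

module Submission where

-- For unmarked p let L(p) be the largest label of a marked element below p and H(p) the
-- smallest label of a marked element above p; both are attained at the ends of saturated
-- chains through p whose inner elements are unmarked. Unit vectors e_p satisfy every
-- inequality Σ_{i∈I} x_i ≤ 1, which forces λ(b) - λ(a) ≥ 1 across every unmarked interval,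
-- and in fact H(p) = L(p) + 1. Let Q be the order on P∖P* generated by the covers between
-- unmarked elements. Regularity makes H weakly decreasing along Q, so every Q-chain
-- c₀ ⊏ ... ⊏ c_k lies on a saturated chain from a to b with λ(b) - λ(a) ≤ 1. If no I
-- contained c₀, ..., c_k, the vector with value 2/(2k+1) on the chain would satisfy all the
-- inequalities while its sum over the chain exceeds 1, contradicting the description. So
-- every Q-chain lies in some I, and the inequalities of 𝒞(P,λ) are exactly the chain
-- inequalities of Q. Deciding ≼ needs excluded middle, but "some I contains the chain" is
-- decidable, so its double negation suffices.

open import Defs

open import Algebra.Bundles using (CommutativeRing)
open import Algebra.Structures using (IsCommutativeRing)
open import Data.Bool.Base using (true; false)
open import Data.Fin.Base using (Fin; zero; suc)
open import Data.Fin.Properties using (_≟_; any?; sequence)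
open import Data.Fin.Subset using (Subset; _∈_; _∉_; _⊂_; _⊆_; ∁)
open import Data.Fin.Subset.Induction using (⊂-wellFounded)
open import Data.Fin.Subset.Properties using (_∈?_; x∈∁p⇒x∉p)
open import Data.List.Base using (List; []; _∷_; _++_; length; filter; allFin)
open import Data.List.Membership.Propositional using (find; lose) renaming (_∈_ to _∈ₗ_; _∉_ to _∉ₗ_)
open import Data.List.Membership.Propositional.Properties using (∈-filter⁺; ∈-allFin; ∈-++⁺ʳ)
open import Data.List.Relation.Binary.Sublist.Propositional using ([]; _∷_; _∷ʳ_; ⊆-refl; ⊆-trans) renaming (_⊆_ to _⊆ₗ_)
open import Data.List.Relation.Binary.Sublist.Propositional.Properties using (++⁺ˡ; []⊆-universal; ∷ʳ⁻¹)
open import Data.List.Relation.Unary.All as All using (All; []; _∷_)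
open import Data.List.Relation.Unary.All.Properties using (all-filter; ¬All⇒Any¬) renaming (++⁺ to All-++⁺)
import Data.List.Relation.Unary.Any as ListAny
open ListAny using (Any)
open import Data.List.Relation.Unary.Unique.Propositional using (Unique; []; _∷_)
open import Data.Nat.Base as ℕ using (ℕ; zero; suc)
open import Data.Product.Base using (Σ; ∃; _×_; _,_; proj₁; proj₂)
open import Data.Sum.Base using (_⊎_; inj₁; inj₂)
open import Data.Vec.Base using ([]; _∷_; _[_]=_; tabulate)
open _[_]=_ using (here; there)
open import Data.Vec.Properties using (lookup∘tabulate; lookup⇒[]=; []=⇒lookup)
open import Effect.Monad using (RawMonad)
open import Function.Base using (_∘_; flip)
open import Function.Bundles using (Equivalence)
open import Induction.WellFounded using (WellFounded; Acc; acc; module Subrelation)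
open import Relation.Binary.Bundles using (TotalOrder)
open import Relation.Binary.Construct.Closure.ReflexiveTransitive using (Star; ε; _◅_; _◅◅_)
import Relation.Binary.Construct.On as On
open import Relation.Binary.Core using (Rel)
open import Relation.Binary.Definitions using (Transitive; Irreflexive) renaming (Decidable to Decidable₂)
import Relation.Binary.Properties.TotalOrder
open import Relation.Binary.PropositionalEquality using (_≡_; _≢_; refl; sym; trans; cong; cong₂; subst₂)
import Relation.Binary.Reasoning.PartialOrder
open import Relation.Binary.Structures using (IsPartialOrder)
open import Relation.Nullary.Decidable using (dec-true)
open import Relation.Nullary.Decidable.Core using (yes; no; does; _×-dec_; ¬?; ¬¬-excluded-middle; decidable-stable)
open import Relation.Nullary.Negation using (¬_; contradiction; ¬¬-map; ¬¬-Monad)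
open import Relation.Unary using (Pred; Decidable)

module OrderedFieldProperties (F : OrderedField) where
  open OrderedField F hiding (+-mono-≤)
  open OrderedField F public using () renaming (+-mono-≤ to +-monoˡ-≤)
  open IsCommutativeRing isCommutativeRing public using (+-assoc; +-comm; +-identityˡ; +-identityʳ)
  open IsCommutativeRing isCommutativeRing using (-‿inverseˡ; -‿inverseʳ; *-identityˡ; zeroʳ)

  commutativeRing : CommutativeRing _ _
  commutativeRing = record { isCommutativeRing = isCommutativeRing }

  open CommutativeRing commutativeRing using (semiring; ring; +-commutativeMonoid; +-commutativeSemigroup)
  open import Algebra.Properties.Ring ring using (-‿distribʳ-*; -1*x≈-x; -‿involutive)
  open import Algebra.Properties.CommutativeSemigroup +-commutativeSemigroup public using (xy∙z≈xz∙y; xy∙z≈y∙xz)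
  open import Algebra.Properties.CommutativeMonoid.Mult +-commutativeMonoid using (×-distrib-+)
  open import Algebra.Properties.Semiring.Mult semiring public
    using () renaming (_×_ to _·_)
  open import Algebra.Properties.Semiring.Mult semiring using (×-assoc-*; ×-homo-+)

  ≤-totalOrder : TotalOrder _ _ _
  ≤-totalOrder = record { isTotalOrder = isTotalOrder }

  open TotalOrder ≤-totalOrder public
    using (poset; total; antisym) renaming (refl to ≤-refl; trans to ≤-trans; reflexive to ≤-reflexive)
  open Relation.Binary.Properties.TotalOrder ≤-totalOrder public using (≥-totalOrder)

  module ≤-Reasoning = Relation.Binary.Reasoning.PartialOrder poset
  open ≤-Reasoning

  x+y-y≡x : ∀ x y → (x + y) - y ≡ x
  x+y-y≡x x y = trans (+-assoc x y (- y)) (trans (cong (x +_) (-‿inverseʳ y)) (+-identityʳ x))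

  x-y+y≡x : ∀ x y → (x - y) + y ≡ x
  x-y+y≡x x y = trans (+-assoc x (- y) y) (trans (cong (x +_) (-‿inverseˡ y)) (+-identityʳ x))

  +-monoʳ-≤ : ∀ {x y} z → x ≤ y → z + x ≤ z + y
  +-monoʳ-≤ {x} {y} z x≤y = subst₂ _≤_ (+-comm x z) (+-comm y z) (+-monoˡ-≤ z x≤y)

  +-mono-≤ : ∀ {x y u v} → x ≤ y → u ≤ v → x + u ≤ y + v
  +-mono-≤ {y = y} {u} x≤y u≤v = ≤-trans (+-monoˡ-≤ u x≤y) (+-monoʳ-≤ y u≤v)

  +-cancelʳ-≤ : ∀ {x y} z → x + z ≤ y + z → x ≤ y
  +-cancelʳ-≤ {x} {y} z le = subst₂ _≤_ (x+y-y≡x x z) (x+y-y≡x y z) (+-monoˡ-≤ (- z) le)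

  +-cancelˡ-≤ : ∀ {x y} z → z + x ≤ z + y → x ≤ y
  +-cancelˡ-≤ {x} {y} z le = +-cancelʳ-≤ z (subst₂ _≤_ (+-comm z x) (+-comm z y) le)

  x+y≤z⇒x≤z-y : ∀ {x y z} → x + y ≤ z → x ≤ z - y
  x+y≤z⇒x≤z-y {x} {y} le = subst₂ _≤_ (x+y-y≡x x y) refl (+-monoˡ-≤ (- y) le)

  x≤z-y⇒x+y≤z : ∀ {x y z} → x ≤ z - y → x + y ≤ z
  x≤z-y⇒x+y≤z {x} {y} {z} le = subst₂ _≤_ refl (x-y+y≡x z y) (+-monoˡ-≤ y le)

  x≤y⇒0≤y-x : ∀ {x y} → x ≤ y → 0# ≤ y - x
  x≤y⇒0≤y-x le = x+y≤z⇒x≤z-y (subst₂ _≤_ (sym (+-identityˡ _)) refl le)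

  x≤y+x : ∀ {x y} → 0# ≤ y → x ≤ y + x
  x≤y+x {x} 0≤y = subst₂ _≤_ (+-identityˡ x) refl (+-monoˡ-≤ x 0≤y)

  x≤x+y : ∀ {x y} → 0# ≤ y → x ≤ x + y
  x≤x+y {x} {y} 0≤y = subst₂ _≤_ refl (+-comm y x) (x≤y+x 0≤y)

  +-nonneg : ∀ {x y} → 0# ≤ x → 0# ≤ y → 0# ≤ x + y
  +-nonneg {x} 0≤x 0≤y = ≤-trans 0≤x (x≤x+y 0≤y)

  x+y≤x⇒y≤0 : ∀ {x y} → x + y ≤ x → y ≤ 0#
  x+y≤x⇒y≤0 {x} le = +-cancelˡ-≤ x (subst₂ _≤_ refl (sym (+-identityʳ x)) le)

  ≤0⇒0≤- : ∀ {x} → x ≤ 0# → 0# ≤ - x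
  ≤0⇒0≤- {x} x≤0 = subst₂ _≤_ (-‿inverseʳ x) (+-identityˡ (- x)) (+-monoˡ-≤ (- x) x≤0)

  ·-nonneg : ∀ k {x} → 0# ≤ x → 0# ≤ k · x
  ·-nonneg zero    0≤x = ≤-refl
  ·-nonneg (suc k) 0≤x = +-nonneg 0≤x (·-nonneg k 0≤x)

  0≤-1⇒1≤0 : 0# ≤ - 1# → 1# ≤ 0#
  0≤-1⇒1≤0 le = subst₂ _≤_ (+-identityʳ 1#) (-‿inverseʳ 1#) (+-monoʳ-≤ 1# le)

  0≤1 : 0# ≤ 1#
  0≤1 with total 0# 1#
  ... | inj₁ 0≤1 = 0≤1
  ... | inj₂ 1≤0 = subst₂ _≤_ refl (-1*-1≡1) (*-nonneg (≤0⇒0≤- 1≤0) (≤0⇒0≤- 1≤0))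
    where
    -1*-1≡1 : (- 1#) * (- 1#) ≡ 1#
    -1*-1≡1 = trans (-1*x≈-x (- 1#)) (-‿involutive 1#)

  1≰0 : ¬ (1# ≤ 0#)
  1≰0 1≤0 = 0≢1 (antisym 0≤1 1≤0)

  inverse-nonneg : ∀ {x y} → 0# ≤ x → x * y ≡ 1# → 0# ≤ y
  inverse-nonneg {x} {y} 0≤x xy≡1 with total 0# y
  ... | inj₁ 0≤y = 0≤y
  ... | inj₂ y≤0 = contradiction (0≤-1⇒1≤0 0≤-1) 1≰0
    where
    0≤-1 : 0# ≤ - 1#
    0≤-1 = subst₂ _≤_ refl (trans (sym (-‿distribʳ-* x y)) (cong -_ xy≡1)) (*-nonneg 0≤x (≤0⇒0≤- y≤0))

  -- t = 2 / (2k + 1): then k·t = 1 - t/2 and (1 + k)·t = 1 + t/2.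
  ∃-k·t≤1<[1+k]·t : ∀ k → Σ Carrier λ t → 0# ≤ t × k · t ≤ 1# × ¬ (suc k · t ≤ 1#)
  ∃-k·t≤1<[1+k]·t k = s + s , +-nonneg 0≤s 0≤s , k·t≤1 , [1+k]·t≰1
    where
    m = suc (k ℕ.+ k) · 1#
    m≢0 : m ≢ 0#
    m≢0 m≡0 = 1≰0 (subst₂ _≤_ refl m≡0 (x≤x+y (·-nonneg (k ℕ.+ k) 0≤1)))
    s = m ⁻¹[ m≢0 ]
    0≤s : 0# ≤ s
    0≤s = inverse-nonneg (+-nonneg 0≤1 (·-nonneg (k ℕ.+ k) 0≤1)) (⁻¹-inverse m m≢0)
    s≢0 : s ≢ 0#
    s≢0 s≡0 = 0≢1 (trans (sym (zeroʳ m)) (trans (cong (m *_) (sym s≡0)) (⁻¹-inverse m m≢0)))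
    s+2k·s≡1 : s + (k ℕ.+ k) · s ≡ 1#
    s+2k·s≡1 = begin-equality
      suc (k ℕ.+ k) · s          ≡⟨ cong (suc (k ℕ.+ k) ·_) (sym (*-identityˡ s)) ⟩
      suc (k ℕ.+ k) · (1# * s)   ≡⟨ sym (×-assoc-* (suc (k ℕ.+ k)) 1# s) ⟩
      m * s                      ≡⟨ ⁻¹-inverse m m≢0 ⟩
      1#                         ∎
    k·t≡2k·s : k · (s + s) ≡ (k ℕ.+ k) · s
    k·t≡2k·s = trans (×-distrib-+ s s k) (sym (×-homo-+ s k k))
    k·t≤1 : k · (s + s) ≤ 1#
    k·t≤1 = begin
      k · (s + s)          ≡⟨ k·t≡2k·s ⟩
      (k ℕ.+ k) · s        ≤⟨ x≤y+x 0≤s ⟩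
      s + (k ℕ.+ k) · s    ≡⟨ s+2k·s≡1 ⟩
      1#                   ∎
    [1+k]·t≰1 : ¬ (suc k · (s + s) ≤ 1#)
    [1+k]·t≰1 le = s≢0 (antisym (x+y≤x⇒y≤0 (≤-trans (≤-reflexive 1+s≡[1+k]·t) le)) 0≤s)
      where
      1+s≡[1+k]·t : 1# + s ≡ suc k · (s + s)
      1+s≡[1+k]·t = begin-equality
        1# + s                          ≡⟨ cong (_+ s) (sym s+2k·s≡1) ⟩
        (s + (k ℕ.+ k) · s) + s         ≡⟨ xy∙z≈xz∙y s _ s ⟩
        (s + s) + (k ℕ.+ k) · s         ≡⟨ cong ((s + s) +_) (sym k·t≡2k·s) ⟩
        (s + s) + k · (s + s)           ∎

module Sums (F : OrderedField) where
  open OrderedField F hiding (+-mono-≤)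
  open OrderedFieldProperties F
  open ≤-Reasoning
  open CommutativeRing commutativeRing using (+-commutativeSemigroup)
  open import Algebra.Properties.CommutativeSemigroup +-commutativeSemigroup using (interchange)

  private
    variable
      n : ℕ

  pointMass : Fin n → Carrier → Fin n → Carrier
  pointMass zero    u zero    = u
  pointMass zero    u (suc _) = 0#
  pointMass (suc p) u zero    = 0#
  pointMass (suc p) u (suc i) = pointMass p u i

  pointMass-≡ : ∀ (p : Fin n) u → pointMass p u p ≡ u
  pointMass-≡ zero    u = refl
  pointMass-≡ (suc p) u = pointMass-≡ p u

  pointMass-≢ : ∀ (p : Fin n) u {i} → i ≢ p → pointMass p u i ≡ 0#
  pointMass-≢ zero    u {zero}  i≢p = contradiction refl i≢p
  pointMass-≢ zero    u {suc i} i≢p = refl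
  pointMass-≢ (suc p) u {zero}  i≢p = refl
  pointMass-≢ (suc p) u {suc i} i≢p = pointMass-≢ p u (λ i≡p → i≢p (cong suc i≡p))

  pointMass-nonneg : ∀ (p : Fin n) {u} → 0# ≤ u → ∀ i → 0# ≤ pointMass p u i
  pointMass-nonneg zero    0≤u zero    = 0≤u
  pointMass-nonneg zero    0≤u (suc i) = ≤-refl
  pointMass-nonneg (suc p) 0≤u zero    = ≤-refl
  pointMass-nonneg (suc p) 0≤u (suc i) = pointMass-nonneg p 0≤u i

  sumSubset-zero : ∀ (I : Subset n) {f} → (∀ i → i ∈ I → f i ≡ 0#) → sumSubset F I f ≡ 0#
  sumSubset-zero []          f≡0 = refl
  sumSubset-zero (true ∷ I)  f≡0 =
    trans (cong₂ _+_ (f≡0 zero here) (sumSubset-zero I (λ i i∈I → f≡0 (suc i) (there i∈I)))) (+-identityˡ 0#)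
  sumSubset-zero (false ∷ I) f≡0 = sumSubset-zero I (λ i i∈I → f≡0 (suc i) (there i∈I))

  sumSubset-single : ∀ (I : Subset n) {f p} → p ∈ I → (∀ i → i ≢ p → f i ≡ 0#) → sumSubset F I f ≡ f p
  sumSubset-single (true ∷ I)  {p = zero}  here        f≡0 =
    trans (cong (_ +_) (sumSubset-zero I (λ i _ → f≡0 (suc i) λ ()))) (+-identityʳ _)
  sumSubset-single (true ∷ I)  {p = suc p} (there p∈I) f≡0 =
    trans (cong₂ _+_ (f≡0 zero λ ()) (sumSubset-single I p∈I (λ i i≢p → f≡0 (suc i) (λ where refl → i≢p refl))))
          (+-identityˡ _)
  sumSubset-single (false ∷ I) {p = suc p} (there p∈I) f≡0 =
    sumSubset-single I p∈I (λ i i≢p → f≡0 (suc i) (λ where refl → i≢p refl))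

  sumSubset-+ : ∀ (I : Subset n) f g → sumSubset F I (λ i → f i + g i) ≡ sumSubset F I f + sumSubset F I g
  sumSubset-+ []          f g = sym (+-identityˡ 0#)
  sumSubset-+ (true ∷ I)  f g = trans (cong (_ +_) (sumSubset-+ I _ _)) (interchange _ _ _ _)
  sumSubset-+ (false ∷ I) f g = sumSubset-+ I _ _

  sumSubset-mono : ∀ (I : Subset n) {f g} → (∀ i → i ∈ I → f i ≤ g i) → sumSubset F I f ≤ sumSubset F I g
  sumSubset-mono []          f≤g = ≤-refl
  sumSubset-mono (true ∷ I)  f≤g = +-mono-≤ (f≤g zero here) (sumSubset-mono I (λ i i∈I → f≤g (suc i) (there i∈I)))
  sumSubset-mono (false ∷ I) f≤g = sumSubset-mono I (λ i i∈I → f≤g (suc i) (there i∈I))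

  sumSubset-pointMass-∈ : ∀ (I : Subset n) {p} u → p ∈ I → sumSubset F I (pointMass p u) ≡ u
  sumSubset-pointMass-∈ I {p} u p∈I = trans (sumSubset-single I p∈I (λ i → pointMass-≢ p u)) (pointMass-≡ p u)

  sumSubset-pointMass-∉ : ∀ (I : Subset n) {p} u → p ∉ I → sumSubset F I (pointMass p u) ≡ 0#
  sumSubset-pointMass-∉ I {p} u p∉I = sumSubset-zero I (λ i i∈I → pointMass-≢ p u (λ where refl → p∉I i∈I))

  sumSubset-pointMass-≤ : ∀ (I : Subset n) p {u} → 0# ≤ u → sumSubset F I (pointMass p u) ≤ u
  sumSubset-pointMass-≤ I p {u} 0≤u with p ∈? I
  ... | yes p∈I = ≤-reflexive (sumSubset-pointMass-∈ I u p∈I)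
  ... | no  p∉I = subst₂ _≤_ (sym (sumSubset-pointMass-∉ I u p∉I)) refl 0≤u

  sumList-zero : ∀ {f} (cs : List (Fin n)) → All (λ c → f c ≡ 0#) cs → sumList F f cs ≡ 0#
  sumList-zero []       []           = refl
  sumList-zero (c ∷ cs) (fc≡0 ∷ f≡0) = trans (cong₂ _+_ fc≡0 (sumList-zero cs f≡0)) (+-identityˡ 0#)

  sumList-single : ∀ {f p} {cs : List (Fin n)} → Unique cs → p ∈ₗ cs → (∀ c → c ≢ p → f c ≡ 0#) →
                   sumList F f cs ≡ f p
  sumList-single {cs = c ∷ cs} (c∉cs ∷ _) (ListAny.here refl) f≡0 =
    trans (cong (_ +_) (sumList-zero cs (All.map (λ c′≢c → f≡0 _ (λ where refl → c′≢c refl)) c∉cs))) (+-identityʳ _)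
  sumList-single {cs = c ∷ cs} (c∉cs ∷ u) (ListAny.there p∈cs) f≡0 =
    trans (cong₂ _+_ (f≡0 c (λ where refl → All.lookup c∉cs p∈cs refl)) (sumList-single u p∈cs f≡0)) (+-identityˡ _)

  sumList-+ : ∀ f g (cs : List (Fin n)) → sumList F (λ c → f c + g c) cs ≡ sumList F f cs + sumList F g cs
  sumList-+ f g []       = sym (+-identityˡ 0#)
  sumList-+ f g (c ∷ cs) = trans (cong (_ +_) (sumList-+ f g cs)) (interchange _ _ _ _)

  sumList-nonneg : ∀ {f} → (∀ i → 0# ≤ f i) → (cs : List (Fin n)) → 0# ≤ sumList F f cs
  sumList-nonneg 0≤f []       = ≤-refl
  sumList-nonneg 0≤f (c ∷ cs) = +-nonneg (0≤f c) (sumList-nonneg 0≤f cs)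

  sumList-⊆ : ∀ {f} → (∀ i → 0# ≤ f i) → {cs ds : List (Fin n)} → cs ⊆ₗ ds → sumList F f cs ≤ sumList F f ds
  sumList-⊆ 0≤f []         = ≤-refl
  sumList-⊆ 0≤f (d ∷ʳ σ)   = ≤-trans (sumList-⊆ 0≤f σ) (x≤y+x (0≤f d))
  sumList-⊆ 0≤f (refl ∷ σ) = +-monoʳ-≤ _ (sumList-⊆ 0≤f σ)

  sumList-cong : ∀ {f g} (cs : List (Fin n)) → All (λ c → f c ≡ g c) cs → sumList F f cs ≡ sumList F g cs
  sumList-cong []       []           = refl
  sumList-cong (c ∷ cs) (fc≡gc ∷ f≡g) = cong₂ _+_ fc≡gc (sumList-cong cs f≡g)

  sumList-const : ∀ t (cs : List (Fin n)) → sumList F (λ _ → t) cs ≡ length cs · t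
  sumList-const t []       = refl
  sumList-const t (c ∷ cs) = cong (t +_) (sumList-const t cs)

  sumList-≤-missing : ∀ {f t} → (∀ c → f c ≤ t) → {c : Fin n} {cs : List (Fin n)} → c ∈ₗ cs → f c ≡ 0# →
                      sumList F f cs + t ≤ length cs · t
  sumList-≤-missing {f = f} {t = t} f≤t {cs = c ∷ cs} (ListAny.here refl) fc≡0 = begin
    (f c + sumList F f cs) + t   ≡⟨ cong (λ z → (z + sumList F f cs) + t) fc≡0 ⟩
    (0# + sumList F f cs) + t    ≡⟨ trans (cong (_+ t) (+-identityˡ _)) (+-comm _ t) ⟩
    t + sumList F f cs           ≤⟨ +-monoʳ-≤ t (sumList-≤ cs) ⟩
    t + length cs · t            ∎
    where
    sumList-≤ : ∀ cs → sumList F f cs ≤ length cs · t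
    sumList-≤ []       = ≤-refl
    sumList-≤ (c ∷ cs) = +-mono-≤ (f≤t c) (sumList-≤ cs)
  sumList-≤-missing {f = f} {t = t} f≤t {cs = c ∷ cs} (ListAny.there c′∈cs) fc′≡0 = begin
    (f c + sumList F f cs) + t   ≡⟨ +-assoc _ _ t ⟩
    f c + (sumList F f cs + t)   ≤⟨ +-mono-≤ (f≤t c) (sumList-≤-missing f≤t c′∈cs fc′≡0) ⟩
    t + length cs · t            ∎

  sumSubset-sumList : ∀ (I : Subset n) (g : Fin n → Fin n → Carrier) cs →
                      sumSubset F I (λ i → sumList F (λ c → g c i) cs) ≡ sumList F (λ c → sumSubset F I (g c)) cs
  sumSubset-sumList I g []       = sumSubset-zero I (λ _ _ → refl)
  sumSubset-sumList I g (c ∷ cs) =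
    trans (sumSubset-+ I (g c) (λ i → sumList F (λ c → g c i) cs)) (cong (sumSubset F I (g c) +_) (sumSubset-sumList I g cs))

  sumList-pointMass-∈ : ∀ {p} u {ps : List (Fin n)} → Unique ps → p ∈ₗ ps → sumList F (pointMass p u) ps ≡ u
  sumList-pointMass-∈ {p = p} u uniq p∈ps = trans (sumList-single uniq p∈ps (λ c → pointMass-≢ p u)) (pointMass-≡ p u)

  sumList-pointMass-∉ : ∀ {p} u (ps : List (Fin n)) → p ∉ₗ ps → sumList F (pointMass p u) ps ≡ 0#
  sumList-pointMass-∉ {p = p} u ps p∉ps = sumList-zero ps (All.tabulate (λ c∈ps → pointMass-≢ p u (λ where refl → p∉ps c∈ps)))

  listMass : (Fin n → Carrier) → List (Fin n) → Fin n → Carrier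
  listMass w cs i = sumList F (λ c → pointMass c (w c) i) cs

  listMass-∈ : ∀ w {cs : List (Fin n)} {i} → Unique cs → i ∈ₗ cs → listMass w cs i ≡ w i
  listMass-∈ w {i = i} u i∈cs =
    trans (sumList-single u i∈cs (λ c c≢i → pointMass-≢ c (w c) (λ where refl → c≢i refl))) (pointMass-≡ i (w i))

  listMass-∉ : ∀ w (cs : List (Fin n)) {i} → i ∉ₗ cs → listMass w cs i ≡ 0#
  listMass-∉ w cs i∉cs = sumList-zero cs (All.tabulate (λ {c} c∈cs → pointMass-≢ c (w c) (λ where refl → i∉cs c∈cs)))

  listMass-nonneg : ∀ {w} → (∀ i → 0# ≤ w i) → (cs : List (Fin n)) → ∀ i → 0# ≤ listMass w cs i
  listMass-nonneg 0≤w cs i = sumList-nonneg (λ c → pointMass-nonneg c (0≤w c) i) cs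

  sumList≤sumSubset : ∀ (I : Subset n) {x cs} → Unique cs → All (_∈ I) cs → (∀ i → i ∈ I → 0# ≤ x i) →
                      sumList F x cs ≤ sumSubset F I x
  sumList≤sumSubset I {x} {cs} u cs⊆I 0≤x = begin
    sumList F x cs                                          ≡⟨ sumList-cong cs (All.map (λ {c} c∈I → sym (sumSubset-pointMass-∈ I (x c) c∈I)) cs⊆I) ⟩
    sumList F (λ c → sumSubset F I (pointMass c (x c))) cs  ≡⟨ sym (sumSubset-sumList I (λ c → pointMass c (x c)) cs) ⟩
    sumSubset F I (listMass x cs)                           ≤⟨ sumSubset-mono I listMass≤x ⟩
    sumSubset F I x                                         ∎
    where
    listMass≤x : ∀ i → i ∈ I → listMass x cs i ≤ x i
    listMass≤x i i∈I with ListAny.any? (i ≟_) cs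
    ... | yes i∈cs = ≤-reflexive (listMass-∈ x u i∈cs)
    ... | no  i∉cs = subst₂ _≤_ (sym (listMass-∉ x cs i∉cs)) refl (0≤x i i∈I)

  sumSubset-listMass-∉ : ∀ (I : Subset n) {t} → 0# ≤ t → ∀ {c cs} → c ∈ₗ cs → c ∉ I →
                         sumSubset F I (listMass (λ _ → t) cs) + t ≤ length cs · t
  sumSubset-listMass-∉ I {t} 0≤t {cs = cs} c∈cs c∉I =
    subst₂ _≤_ (cong (_+ t) (sym (sumSubset-sumList I (λ c → pointMass c t) cs))) refl
      (sumList-≤-missing (λ c → sumSubset-pointMass-≤ I c 0≤t) c∈cs (sumSubset-pointMass-∉ I t c∉I))

  sumList-listMass-⊆ : ∀ {t} → 0# ≤ t → ∀ {cs ps : List (Fin n)} → Unique cs → cs ⊆ₗ ps →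
                       length cs · t ≤ sumList F (listMass (λ _ → t) cs) ps
  sumList-listMass-⊆ {t = t} 0≤t {cs} {ps} u cs⊆ps = begin
    length cs · t                           ≡⟨ sym (sumList-const t cs) ⟩
    sumList F (λ _ → t) cs                  ≡⟨ sumList-cong cs (All.tabulate (λ c∈cs → sym (listMass-∈ (λ _ → t) u c∈cs))) ⟩
    sumList F (listMass (λ _ → t) cs) cs    ≤⟨ sumList-⊆ (listMass-nonneg (λ _ → 0≤t) cs) cs⊆ps ⟩
    sumList F (listMass (λ _ → t) cs) ps    ∎

module FiniteOrders {n : ℕ} where

  subsetOf : ∀ {ℓ} {P : Pred (Fin n) ℓ} → Decidable P → Subset n
  subsetOf P? = tabulate (λ i → does (P? i))

  ∈-subsetOf⁺ : ∀ {ℓ} {P : Pred (Fin n) ℓ} (P? : Decidable P) {i} → P i → i ∈ subsetOf P?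
  ∈-subsetOf⁺ P? {i} Pi = lookup⇒[]= i _ (trans (lookup∘tabulate _ i) (dec-true (P? i) Pi))

  ∈-subsetOf⁻ : ∀ {ℓ} {P : Pred (Fin n) ℓ} (P? : Decidable P) {i} → i ∈ subsetOf P? → P i
  ∈-subsetOf⁻ P? {i} i∈P with P? i | trans (sym (lookup∘tabulate _ i)) ([]=⇒lookup i∈P)
  ... | yes Pi | _ = Pi

  -- the predecessor sets strictly shrink along the relation
  finite-wellFounded : ∀ {ℓ} {_<_ : Rel (Fin n) ℓ} → Decidable₂ _<_ → Transitive _<_ → Irreflexive _≡_ _<_ →
                       WellFounded _<_
  finite-wellFounded {_<_ = _<_} _<?_ <-trans <-irrefl =
    Subrelation.wellFounded shrink (On.wellFounded predecessors ⊂-wellFounded)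
    where
    predecessors : Fin n → Subset n
    predecessors j = subsetOf (λ i → i <? j)
    shrink : ∀ {i j} → i < j → predecessors i ⊂ predecessors j
    shrink {i} {j} i<j =
      (λ k∈ → ∈-subsetOf⁺ (_<? j) (<-trans (∈-subsetOf⁻ (_<? i) k∈) i<j)) ,
      i , ∈-subsetOf⁺ (_<? j) i<j , λ i∈ → <-irrefl refl (∈-subsetOf⁻ (_<? i) i∈)

  module _ {b ℓ₁ ℓ₂} (T : TotalOrder b ℓ₁ ℓ₂) where
    open TotalOrder T using (_≤_) renaming (Carrier to B)
    open import Data.List.Extrema T using (argmax; argmax-all; f[xs]≤f[argmax])

    argmax-on : ∀ {ℓ} {P : Pred (Fin n) ℓ} → Decidable P → (f : Fin n → B) → ∀ {i₀} → P i₀ →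
                Σ (Fin n) λ m → P m × (∀ {j} → P j → f j ≤ f m)
    argmax-on P? f {i₀} Pi₀ =
      m , argmax-all f Pi₀ (all-filter P? (allFin n)) ,
      λ Pj → All.lookup (f[xs]≤f[argmax] i₀ candidates) (∈-filter⁺ P? (∈-allFin _) Pj)
      where
      candidates = filter P? (allFin n)
      m = argmax f i₀ candidates

module MarkedPosetProperties (F : OrderedField) (M : MarkedPoset F) where
  open OrderedField F hiding (+-mono-≤)
  open OrderedFieldProperties F
  open Sums F
  open MarkedPoset M
  open IsPartialOrder isPartialOrder using () renaming (refl to ≼-refl; trans to ≼-trans; antisym to ≼-antisym)
  open ≤-Reasoning

  private
    variable
      a b c d p q : Fin n
      cs ps qs : List (Fin n)

  ≺-trans : a ≺ b → b ≺ c → a ≺ c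
  ≺-trans (a≼b , a≢b) (b≼c , b≢c) = ≼-trans a≼b b≼c , λ where refl → a≢b (≼-antisym a≼b b≼c)

  ⋖⇒≼ : a ⋖ b → a ≼ b
  ⋖⇒≼ a⋖b = proj₁ (proj₁ a⋖b)

  ⋖⇒unique-pair : p ⋖ q → Unique (p ∷ q ∷ [])
  ⋖⇒unique-pair p⋖q = (proj₂ (proj₁ p⋖q) ∷ []) ∷ [] ∷ []

  satChain-≼ : SatChain a ps b → a ≼ b
  satChain-≼ (done a⋖b)   = ⋖⇒≼ a⋖b
  satChain-≼ (step a⋖p s) = ≼-trans (⋖⇒≼ a⋖p) (satChain-≼ s)

  satChain-≺ : SatChain a ps b → All (a ≺_) ps
  satChain-≺ (done _)     = []
  satChain-≺ (step a⋖p s) = proj₁ a⋖p ∷ All.map (≺-trans (proj₁ a⋖p)) (satChain-≺ s)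

  satChain-unique : SatChain a ps b → Unique ps
  satChain-unique (done _)   = []
  satChain-unique (step _ s) = All.map proj₂ (satChain-≺ s) ∷ satChain-unique s

  satChain-between : SatChain a ps b → c ∈ₗ ps → a ≼ c × c ≼ b
  satChain-between (step a⋖p s) (ListAny.here refl)  = ⋖⇒≼ a⋖p , satChain-≼ s
  satChain-between (step a⋖p s) (ListAny.there c∈ps) =
    ≼-trans (⋖⇒≼ a⋖p) (proj₁ (satChain-between s c∈ps)) , proj₂ (satChain-between s c∈ps)

  satChain-++ : SatChain a ps p → SatChain p qs b → SatChain a (ps ++ p ∷ qs) b
  satChain-++ (done a⋖p)   t = step a⋖p t
  satChain-++ (step a⋖r s) t = step a⋖r (satChain-++ s t)

  Route : Fin n → List (Fin n) → Fin n → Set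
  Route a ps b = All (_∉ marked) ps × SatChain a ps b

  route-++ : Route a ps p → p ∉ marked → Route p qs b → Route a (ps ++ p ∷ qs) b
  route-++ (ps-unmarked , s) pu (qs-unmarked , t) = All-++⁺ ps-unmarked (pu ∷ qs-unmarked) , satChain-++ s t

  route-≤ : a ∈ marked → b ∈ marked → Route a ps b → lab a ≤ lab b
  route-≤ am bm (_ , s) = λ-monotone am bm (satChain-≼ s)

  record Descent (p : Fin n) : Set where
    constructor descent
    field
      source        : Fin n
      source-marked : source ∈ marked
      steps         : List (Fin n)
      route         : Route source steps p

  record Ascent (p : Fin n) : Set where
    constructor ascent
    field
      target        : Fin n
      target-marked : target ∈ marked
      steps         : List (Fin n)
      route         : Route p steps target

  _⋖ᵘ_ : Rel (Fin n) _
  c ⋖ᵘ d = c ⋖ d × d ∉ marked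

  _⊑_ : Rel (Fin n) _
  _⊑_ = Star _⋖ᵘ_

  ⊑⇒≼ : c ⊑ d → c ≼ d
  ⊑⇒≼ ε                  = ≼-refl
  ⊑⇒≼ ((c⋖e , _) ◅ e⊑d) = ≼-trans (⋖⇒≼ c⋖e) (⊑⇒≼ e⊑d)

  Q : PosetOnUnmarked F M
  Q = record
    { _⊑_       = _⊑_
    ; ⊑-refl    = λ _ → ε
    ; ⊑-antisym = λ _ _ c⊑d d⊑c → ≼-antisym (⊑⇒≼ c⊑d) (⊑⇒≼ d⊑c)
    ; ⊑-trans   = λ _ _ _ → _◅◅_
    }

  open PosetOnUnmarked Q using (IsChain; InChainPolytope) renaming ([] to []ᶜ; [_] to [_]ᶜ; _∷_ to cons)

  prepend : c ⊑ d → Route d ps b → Σ (List (Fin n)) λ qs → Route c qs b × (d ∷ ps) ⊆ₗ (c ∷ qs)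
  prepend ε r = _ , r , ⊆-refl
  prepend ((c⋖e , eu) ◅ e⊑d) r with prepend e⊑d r
  ... | qs , (qs-unmarked , s) , σ = _ ∷ qs , (eu ∷ qs-unmarked , step c⋖e s) , _ ∷ʳ σ

  chain-≺ : IsChain (c ∷ cs) → All (c ≺_) cs
  chain-≺ [ _ ]ᶜ                        = []
  chain-≺ (cons _ (c⊑d , c≢d) d∷ds-chain) = c≺d ∷ All.map (≺-trans c≺d) (chain-≺ d∷ds-chain)
    where c≺d = ⊑⇒≼ c⊑d , c≢d

  chain-unique : IsChain cs → Unique cs
  chain-unique []ᶜ                        = []
  chain-unique [ _ ]ᶜ                     = [] ∷ []
  chain-unique ch@(cons _ _ d∷ds-chain) = All.map proj₂ (chain-≺ ch) ∷ chain-unique d∷ds-chain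

  chain-head-unmarked : IsChain (c ∷ cs) → c ∉ marked
  chain-head-unmarked [ cu ]ᶜ      = cu
  chain-head-unmarked (cons cu _ _) = cu

  route⇒chain : Route a (p ∷ ps) b → IsChain (p ∷ ps)
  route⇒chain (pu ∷ []      , step _ (done _))      = [ pu ]ᶜ
  route⇒chain (pu ∷ qu ∷ us , step _ (step p⋖q s)) =
    cons pu ((p⋖q , qu) ◅ ε , proj₂ (proj₁ p⋖q)) (route⇒chain (qu ∷ us , step p⋖q s))

  regular-⋖ : Regular → p ⋖ q → p ∉ marked → q ∉ marked →
              a ∈ marked → b ∈ marked → a ≼ q → p ≼ b → lab a < lab b
  regular-⋖ regular p⋖q pu qu am bm a≼q p≼b with regular p⋖q am bm a≼q p≼b
  ... | inj₂ a<b = a<b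
  ... | inj₁ refl with proj₂ p⋖q _ p≼b a≼q
  ...   | inj₁ refl = contradiction am pu
  ...   | inj₂ refl = contradiction am qu

  module WithDescription
    (J : Subset n) (𝓘 : List (Subset n)) (𝓘-unmarked : All (_⊆ ∁ marked) 𝓘)
    (describes : ∀ x → (InMarkedChainPolytope F M x → SatisfiesSystem F M J 𝓘 x) ×
                       (SatisfiesSystem F M J 𝓘 x → InMarkedChainPolytope F M x))
    where

    private
      variable
        x y : Fin n → Carrier

    𝒞 : (Fin n → Carrier) → Set
    𝒞 = InMarkedChainPolytope F M

    System : (Fin n → Carrier) → Set
    System = SatisfiesSystem F M J 𝓘

    Covered : List (Fin n) → Set
    Covered cs = Any (λ I → All (_∈ I) cs) 𝓘

    covered? : Decidable Covered
    covered? cs = ListAny.any? (λ I → All.all? (_∈? I) cs) 𝓘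

    system-intro : (∀ i → 0# ≤ y i) → (∀ {I} → I ∈ₗ 𝓘 → sumSubset F I y ≤ 1#) → System y
    system-intro 0≤y sum≤1 = (λ i _ → 0≤y i) , All.tabulate sum≤1

    𝒞-intro : (∀ i → 0# ≤ y i) →
              (∀ {a ps b} → a ∈ marked → b ∈ marked → Route a ps b → sumList F y ps + lab a ≤ lab b) → 𝒞 y
    𝒞-intro 0≤y bound = (λ i _ → 0≤y i) , λ a ps b am bm ps-unmarked s → x+y≤z⇒x≤z-y (bound am bm (ps-unmarked , s))

    𝒞-bound : 𝒞 y → a ∈ marked → b ∈ marked → Route a ps b → sumList F y ps + lab a ≤ lab b
    𝒞-bound (_ , bound) am bm (ps-unmarked , s) = x≤z-y⇒x+y≤z (bound _ _ _ am bm ps-unmarked s)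

    system⇒𝒞 : System y → 𝒞 y
    system⇒𝒞 {y} = proj₂ (describes y)

    𝒞⇒system : 𝒞 y → System y
    𝒞⇒system {y} = proj₁ (describes y)

    pointMass-system : ∀ p → System (pointMass p 1#)
    pointMass-system p = system-intro (pointMass-nonneg p 0≤1) (λ {I} _ → sumSubset-pointMass-≤ I p 0≤1)

    route-gap : a ∈ marked → b ∈ marked → Route a ps b → p ∈ₗ ps → 1# + lab a ≤ lab b
    route-gap {a} {b} {ps} {p} am bm r p∈ps = begin
      1# + lab a                             ≡⟨ cong (_+ lab a) (sumList-pointMass-∈ 1# (satChain-unique (proj₂ r)) p∈ps) ⟨
      sumList F (pointMass p 1#) ps + lab a  ≤⟨ 𝒞-bound (system⇒𝒞 (pointMass-system p)) am bm r ⟩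
      lab b                                  ∎

    chain-bound : 𝒞 x → Unique cs → Covered cs → sumList F x cs ≤ 1#
    chain-bound {x} {cs} x∈𝒞 uniq = All.lookupWith bound (All.zip (proj₂ (𝒞⇒system x∈𝒞) , 𝓘-unmarked))
      where
      bound : ∀ {I} → sumSubset F I x ≤ 1# × I ⊆ ∁ marked → All (_∈ I) cs → sumList F x cs ≤ 1#
      bound {I} (sum≤1 , I-unmarked) cs⊆I =
        ≤-trans (sumList≤sumSubset I uniq cs⊆I (λ i i∈I → proj₁ x∈𝒞 i (x∈∁p⇒x∉p (I-unmarked i∈I)))) sum≤1

    -- t on every element of an uncovered cs satisfies all the inequalities Σ_{i∈I} x_i ≤ 1
    uncovered-gap : ∀ {k t} → ¬ Covered cs → Unique cs → length cs ≡ suc k → 0# ≤ t → k · t ≤ 1# →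
                    a ∈ marked → b ∈ marked → Route a ps b → cs ⊆ₗ ps → suc k · t + lab a ≤ lab b
    uncovered-gap {cs} {a} {b} {ps} {k} {t} uncovered uniq |cs|≡1+k 0≤t k·t≤1 am bm r cs⊆ps = begin
      suc k · t + lab a                             ≡⟨ cong (λ m → m · t + lab a) |cs|≡1+k ⟨
      length cs · t + lab a                         ≤⟨ +-monoˡ-≤ (lab a) (sumList-listMass-⊆ 0≤t uniq cs⊆ps) ⟩
      sumList F (listMass (λ _ → t) cs) ps + lab a  ≤⟨ 𝒞-bound (system⇒𝒞 y∈system) am bm r ⟩
      lab b                                         ∎
      where
      sum≤1 : ∀ {I} → I ∈ₗ 𝓘 → sumSubset F I (listMass (λ _ → t) cs) ≤ 1#
      sum≤1 {I} I∈𝓘 with find (¬All⇒Any¬ (_∈? I) cs (λ cs⊆I → uncovered (lose I∈𝓘 cs⊆I)))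
      ... | c , c∈cs , c∉I = ≤-trans (+-cancelʳ-≤ t missing) k·t≤1
        where
        missing : sumSubset F I (listMass (λ _ → t) cs) + t ≤ k · t + t
        missing = subst₂ _≤_ refl (trans (cong (_· t) |cs|≡1+k) (+-comm t (k · t)))
                    (sumSubset-listMass-∉ I 0≤t c∈cs c∉I)
      y∈system : System (listMass (λ _ → t) cs)
      y∈system = system-intro (listMass-nonneg (λ _ → 0≤t) cs) sum≤1

    module WithDecidableOrder (minMax : MinMaxMarked) (regular : Regular) (_≼?_ : Decidable₂ _≼_) where
      open FiniteOrders

      _≺?_ : Decidable₂ _≺_
      p ≺? q = (p ≼? q) ×-dec ¬? (p ≟ q)

      ≺-irrefl : Irreflexive _≡_ _≺_
      ≺-irrefl refl (_ , p≢p) = p≢p refl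

      ≺-wellFounded : WellFounded _≺_
      ≺-wellFounded = finite-wellFounded _≺?_ ≺-trans ≺-irrefl

      ≻-wellFounded : WellFounded (flip _≺_)
      ≻-wellFounded = finite-wellFounded (flip _≺?_) (flip ≺-trans) (λ p≡q → ≺-irrefl (sym p≡q))

      ⋖-intro : a ≺ b → ¬ (∃ λ c → a ≺ c × c ≺ b) → a ⋖ b
      ⋖-intro {a} {b} a≺b nothing-between = a≺b , between
        where
        between : ∀ c → a ≼ c → c ≼ b → c ≡ a ⊎ c ≡ b
        between c a≼c c≼b with c ≟ a | c ≟ b
        ... | yes c≡a | _       = inj₁ c≡a
        ... | no  _   | yes c≡b = inj₂ c≡b
        ... | no  c≢a | no  c≢b = contradiction (c , (a≼c , c≢a ∘ sym) , (c≼b , c≢b)) nothing-between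

      cover-below : Acc (flip _≺_) a → a ≺ b → ∃ λ c → a ≼ c × c ⋖ b
      cover-below {a} {b} (acc larger) a≺b with any? (λ c → (a ≺? c) ×-dec (c ≺? b))
      ... | no  none                = a , ≼-refl , ⋖-intro a≺b none
      ... | yes (c , a≺c , c≺b) with cover-below (larger a≺c) c≺b
      ...   | d , c≼d , d⋖b = d , ≼-trans (proj₁ a≺c) c≼d , d⋖b

      cover-above : Acc _≺_ b → a ≺ b → ∃ λ c → a ⋖ c × c ≼ b
      cover-above {b} {a} (acc smaller) a≺b with any? (λ c → (a ≺? c) ×-dec (c ≺? b))
      ... | no  none                = b , ⋖-intro a≺b none , ≼-refl
      ... | yes (c , a≺c , c≺b) with cover-above (smaller c≺b) a≺c
      ...   | d , a⋖d , d≼c = d , a⋖d , ≼-trans d≼c (proj₁ c≺b)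

      minimal-below : Acc _≺_ p → ∃ λ a → IsMinimal a × a ≼ p
      minimal-below {p} (acc smaller) with any? (_≺? p)
      ... | yes (q , q≺p) with minimal-below (smaller q≺p)
      ...   | a , a-min , a≼q = a , a-min , ≼-trans a≼q (proj₁ q≺p)
      minimal-below {p} (acc smaller) | no none = p , p-min , ≼-refl
        where
        p-min : IsMinimal p
        p-min q q≼p with q ≟ p
        ... | yes q≡p = q≡p
        ... | no  q≢p = contradiction (q , q≼p , q≢p) none

      maximal-above : Acc (flip _≺_) p → ∃ λ b → IsMaximal b × p ≼ b
      maximal-above {p} (acc larger) with any? (p ≺?_)
      ... | yes (q , p≺q) with maximal-above (larger p≺q)
      ...   | b , b-max , q≼b = b , b-max , ≼-trans (proj₁ p≺q) q≼b
      maximal-above {p} (acc larger) | no none = p , p-max , ≼-refl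
        where
        p-max : IsMaximal p
        p-max q p≼q with q ≟ p
        ... | yes q≡p = q≡p
        ... | no  q≢p = contradiction (q , p≼q , q≢p ∘ sym) none

      descend : Acc _≺_ p → p ∉ marked → a ∈ marked → a ≼ p → Σ (Descent p) λ δ → a ≼ Descent.source δ
      descend {p} {a} (acc smaller) pu am a≼p with cover-below (≻-wellFounded a) (a≼p , λ where refl → pu am)
      ... | r , a≼r , r⋖p with r ∈? marked
      ...   | yes rm = descent r rm [] ([] , done r⋖p) , a≼r
      ...   | no  ru with descend (smaller (proj₁ r⋖p)) ru am a≼r
      ...     | descent m mm ps m⇝r , a≼m = descent m mm (ps ++ r ∷ []) (route-++ m⇝r ru ([] , done r⋖p)) , a≼m

      ascend : Acc (flip _≺_) p → p ∉ marked → b ∈ marked → p ≼ b → Σ (Ascent p) λ υ → Ascent.target υ ≼ b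
      ascend {p} {b} (acc larger) pu bm p≼b with cover-above (≺-wellFounded b) (p≼b , λ where refl → pu bm)
      ... | r , p⋖r , r≼b with r ∈? marked
      ...   | yes rm = ascent r rm [] ([] , done p⋖r) , r≼b
      ...   | no  ru with ascend (larger (proj₁ p⋖r)) ru bm r≼b
      ...     | ascent m mm qs (qs-unmarked , r⇝m) , m≼b = ascent m mm (r ∷ qs) (ru ∷ qs-unmarked , step p⋖r r⇝m) , m≼b

      opaque
        lowest : p ∉ marked → Σ (Descent p) λ δ → ∀ {a} → a ∈ marked → a ≼ p → lab a ≤ lab (Descent.source δ)
        lowest {p} pu with minimal-below (≺-wellFounded p)
        ... | a₀ , a₀-min , a₀≼p with argmax-on ≤-totalOrder (λ a → (a ∈? marked) ×-dec (a ≼? p)) lab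
                                        (proj₁ minMax a₀ a₀-min , a₀≼p)
        ... | a , (am , a≼p) , a-max = tighten (descend (≺-wellFounded p) pu am a≼p)
          where
          tighten : Σ (Descent p) (λ δ → a ≼ Descent.source δ) →
                    Σ (Descent p) λ δ → ∀ {a} → a ∈ marked → a ≼ p → lab a ≤ lab (Descent.source δ)
          tighten (δ , a≼source) =
            δ , λ a′m a′≼p → ≤-trans (a-max (a′m , a′≼p)) (λ-monotone am (Descent.source-marked δ) a≼source)

        highest : p ∉ marked → Σ (Ascent p) λ υ → ∀ {b} → b ∈ marked → p ≼ b → lab (Ascent.target υ) ≤ lab b
        highest {p} pu with maximal-above (≻-wellFounded p)
        ... | b₀ , b₀-max , p≼b₀ with argmax-on ≥-totalOrder (λ b → (b ∈? marked) ×-dec (p ≼? b)) lab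
                                        (proj₂ minMax b₀ b₀-max , p≼b₀)
        ... | b , (bm , p≼b) , b-min = tighten (ascend (≻-wellFounded p) pu bm p≼b)
          where
          tighten : Σ (Ascent p) (λ υ → Ascent.target υ ≼ b) →
                    Σ (Ascent p) λ υ → ∀ {b} → b ∈ marked → p ≼ b → lab (Ascent.target υ) ≤ lab b
          tighten (υ , target≼b) =
            υ , λ b′m p≼b′ → ≤-trans (λ-monotone (Ascent.target-marked υ) bm target≼b) (b-min (b′m , p≼b′))

      L H : p ∉ marked → Carrier
      L pu = lab (Descent.source (proj₁ (lowest pu)))
      H pu = lab (Ascent.target (proj₁ (highest pu)))

      L-max : (pu : p ∉ marked) → a ∈ marked → a ≼ p → lab a ≤ L pu
      L-max pu = proj₂ (lowest pu)

      H-min : (pu : p ∉ marked) → b ∈ marked → p ≼ b → H pu ≤ lab b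
      H-min pu = proj₂ (highest pu)

      route-through : (pu : p ∉ marked) → a ∈ marked → b ∈ marked → Route a ps b → p ∈ₗ ps →
                      lab a ≤ L pu × H pu ≤ lab b
      route-through pu am bm (_ , s) p∈ps =
        L-max pu am (proj₁ (satChain-between s p∈ps)) , H-min pu bm (proj₂ (satChain-between s p∈ps))

      1+L≤H : (pu : p ∉ marked) → 1# + L pu ≤ H pu
      1+L≤H {p} pu = route-gap source-marked target-marked (route-++ route pu route′) (∈-++⁺ʳ steps (ListAny.here refl))
        where
        open Descent (proj₁ (lowest pu))
        open Ascent (proj₁ (highest pu)) using (target-marked) renaming (route to route′)

      pointMass∈𝒞 : (pu : p ∉ marked) → ∀ {u} → 0# ≤ u → u + L pu ≤ H pu → 𝒞 (pointMass p u)
      pointMass∈𝒞 {p} pu {u} 0≤u u+L≤H = 𝒞-intro (pointMass-nonneg p 0≤u) bound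
        where
        bound : a ∈ marked → b ∈ marked → Route a ps b → sumList F (pointMass p u) ps + lab a ≤ lab b
        bound {a} {b} {ps} am bm r with ListAny.any? (p ≟_) ps
        ... | yes p∈ps = begin
          sumList F (pointMass p u) ps + lab a  ≡⟨ cong (_+ lab a) (sumList-pointMass-∈ u (satChain-unique (proj₂ r)) p∈ps) ⟩
          u + lab a                             ≤⟨ +-monoʳ-≤ u (proj₁ (route-through pu am bm r p∈ps)) ⟩
          u + L pu                              ≤⟨ u+L≤H ⟩
          H pu                                  ≤⟨ proj₂ (route-through pu am bm r p∈ps) ⟩
          lab b                                 ∎
        ... | no p∉ps = begin
          sumList F (pointMass p u) ps + lab a  ≡⟨ cong (_+ lab a) (sumList-pointMass-∉ u ps p∉ps) ⟩
          0# + lab a                            ≡⟨ +-identityˡ (lab a) ⟩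
          lab a                                 ≤⟨ route-≤ am bm r ⟩
          lab b                                 ∎

      singleton-covered : p ∉ marked → Covered (p ∷ [])
      singleton-covered {p} pu = decidable-stable (covered? (p ∷ [])) λ uncovered →
        1≰0 (x+y≤x⇒y≤0 (begin
          H pu + 1#                    ≡⟨ cong (_+ 1#) (x-y+y≡x (H pu) (L pu)) ⟨
          ((H pu - L pu) + L pu) + 1#  ≡⟨ xy∙z≈xz∙y _ (L pu) 1# ⟩
          t + L pu                     ≡⟨ cong (_+ L pu) (+-identityʳ t) ⟨
          1 · t + L pu                 ≤⟨ uncovered-gap uncovered ([] ∷ []) refl 0≤t 0≤1 source-marked target-marked
                                            (route-++ route pu route′) (++⁺ˡ steps (refl ∷ []⊆-universal _)) ⟩
          H pu                         ∎))
        where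
        open Descent (proj₁ (lowest pu))
        open Ascent (proj₁ (highest pu)) using (target-marked) renaming (route to route′)
        t = (H pu - L pu) + 1#
        0≤t : 0# ≤ t
        0≤t = +-nonneg (x≤y⇒0≤y-x (≤-trans (x≤y+x 0≤1) (1+L≤H pu))) 0≤1

      H≤1+L : (pu : p ∉ marked) → H pu ≤ 1# + L pu
      H≤1+L {p} pu = begin
        H pu                  ≡⟨ x-y+y≡x (H pu) (L pu) ⟨
        (H pu - L pu) + L pu  ≤⟨ +-monoˡ-≤ (L pu) H-L≤1 ⟩
        1# + L pu             ∎
        where
        0≤H-L : 0# ≤ H pu - L pu
        0≤H-L = x≤y⇒0≤y-x (≤-trans (x≤y+x 0≤1) (1+L≤H pu))
        H-L≤1 : H pu - L pu ≤ 1#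
        H-L≤1 = subst₂ _≤_ (sumList-pointMass-∈ {p = p} (H pu - L pu) ([] ∷ []) (ListAny.here refl)) refl
                  (chain-bound (pointMass∈𝒞 pu 0≤H-L (≤-reflexive (x-y+y≡x (H pu) (L pu)))) ([] ∷ []) (singleton-covered pu))

      H≡1+L : (pu : p ∉ marked) → H pu ≡ 1# + L pu
      H≡1+L pu = antisym (H≤1+L pu) (1+L≤H pu)

      L<H-⋖ : p ⋖ q → (pu : p ∉ marked) (qu : q ∉ marked) → L qu < H pu
      L<H-⋖ p⋖q pu qu = regular-⋖ regular p⋖q pu qu source-marked target-marked
                          (satChain-≼ (proj₂ source⇝q)) (satChain-≼ (proj₂ p⇝target))
        where
        open Descent (proj₁ (lowest qu)) using (source-marked) renaming (route to source⇝q)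
        open Ascent (proj₁ (highest pu)) using (target-marked) renaming (route to p⇝target)

      twoPoint∈𝒞 : (pu : p ∉ marked) (qu : q ∉ marked) → ∀ {u v} → 0# ≤ u → 0# ≤ v →
                   u + L pu ≤ H pu → v + L qu ≤ H qu → (u + v) + L pu ≤ H qu →
                   𝒞 (λ i → pointMass p u i + pointMass q v i)
      twoPoint∈𝒞 {p} {q} pu qu {u} {v} 0≤u 0≤v u+L≤H v+L≤H u+v+L≤H =
        𝒞-intro (λ i → +-nonneg (pointMass-nonneg p 0≤u i) (pointMass-nonneg q 0≤v i)) bound
        where
        bound : a ∈ marked → b ∈ marked → Route a ps b →
                sumList F (λ i → pointMass p u i + pointMass q v i) ps + lab a ≤ lab b
        bound {a} {b} {ps} am bm r rewrite sumList-+ (pointMass p u) (pointMass q v) ps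
          with ListAny.any? (p ≟_) ps | ListAny.any? (q ≟_) ps
        ... | yes p∈ps | yes q∈ps = begin
          (sumList F (pointMass p u) ps + sumList F (pointMass q v) ps) + lab a
            ≡⟨ cong (_+ lab a) (cong₂ _+_ (sumList-pointMass-∈ u uniq p∈ps) (sumList-pointMass-∈ v uniq q∈ps)) ⟩
          (u + v) + lab a  ≤⟨ +-monoʳ-≤ (u + v) (proj₁ (route-through pu am bm r p∈ps)) ⟩
          (u + v) + L pu   ≤⟨ u+v+L≤H ⟩
          H qu             ≤⟨ proj₂ (route-through qu am bm r q∈ps) ⟩
          lab b            ∎
          where uniq = satChain-unique (proj₂ r)
        ... | _ | no q∉ps = begin
          (sumList F (pointMass p u) ps + sumList F (pointMass q v) ps) + lab a
            ≡⟨ cong (λ s → (sumList F (pointMass p u) ps + s) + lab a) (sumList-pointMass-∉ v ps q∉ps) ⟩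
          (sumList F (pointMass p u) ps + 0#) + lab a
            ≡⟨ cong (_+ lab a) (+-identityʳ _) ⟩
          sumList F (pointMass p u) ps + lab a  ≤⟨ 𝒞-bound (pointMass∈𝒞 pu 0≤u u+L≤H) am bm r ⟩
          lab b                                 ∎
        ... | no p∉ps | _ = begin
          (sumList F (pointMass p u) ps + sumList F (pointMass q v) ps) + lab a
            ≡⟨ cong (λ s → (s + sumList F (pointMass q v) ps) + lab a) (sumList-pointMass-∉ u ps p∉ps) ⟩
          (0# + sumList F (pointMass q v) ps) + lab a
            ≡⟨ cong (_+ lab a) (+-identityˡ _) ⟩
          sumList F (pointMass q v) ps + lab a  ≤⟨ 𝒞-bound (pointMass∈𝒞 qu 0≤v v+L≤H) am bm r ⟩
          lab b                                 ∎

      cover-covered : p ⋖ q → p ∉ marked → q ∉ marked → Covered (p ∷ q ∷ [])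
      cover-covered {p} {q} p⋖q pu qu = decidable-stable (covered? (p ∷ q ∷ [])) λ uncovered →
        proj₂ Lq<Hp (antisym (proj₁ Lq<Hp) (+-cancelˡ-≤ 1# (begin
          1# + H pu             ≡⟨ cong (1# +_) (H≡1+L pu) ⟩
          1# + (1# + L pu)      ≡⟨ trans (cong (λ z → (1# + z) + L pu) (+-identityʳ 1#)) (+-assoc 1# 1# (L pu)) ⟨
          2 · 1# + L pu         ≤⟨ uncovered-gap uncovered (⋖⇒unique-pair p⋖q) refl 0≤1 (≤-reflexive (+-identityʳ 1#))
                                     source-marked target-marked through-p-q (++⁺ˡ steps (refl ∷ refl ∷ []⊆-universal _)) ⟩
          H qu                  ≡⟨ H≡1+L qu ⟩
          1# + L qu             ∎)))
        where
        open Descent (proj₁ (lowest pu)) using (source-marked; steps) renaming (route to source⇝p)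
        open Ascent (proj₁ (highest qu)) using (target-marked) renaming (route to q⇝target)
        Lq<Hp = L<H-⋖ p⋖q pu qu
        through-p-q : Route _ (steps ++ p ∷ q ∷ Ascent.steps (proj₁ (highest qu))) _
        through-p-q = route-++ source⇝p pu (qu ∷ proj₁ q⇝target , step p⋖q (proj₂ q⇝target))

      H-antitone-⋖ : p ⋖ q → (pu : p ∉ marked) (qu : q ∉ marked) → H qu ≤ H pu
      H-antitone-⋖ {p} {q} p⋖q pu qu = begin
        H qu         ≡⟨ x-y+y≡x (H qu) (H pu) ⟨
        v + H pu     ≤⟨ +-monoˡ-≤ (H pu) (x+y≤x⇒y≤0 1+v≤1) ⟩
        0# + H pu    ≡⟨ +-identityˡ (H pu) ⟩
        H pu         ∎
        where
        open Ascent (proj₁ (highest qu)) using (target-marked) renaming (route to q⇝target)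
        v = H qu - H pu
        0≤v : 0# ≤ v
        0≤v = x≤y⇒0≤y-x (H-min pu target-marked (≼-trans (⋖⇒≼ p⋖q) (satChain-≼ (proj₂ q⇝target))))
        v+L≤H : v + L qu ≤ H qu
        v+L≤H = begin
          v + L qu   ≤⟨ +-monoʳ-≤ v (proj₁ (L<H-⋖ p⋖q pu qu)) ⟩
          v + H pu   ≡⟨ x-y+y≡x (H qu) (H pu) ⟩
          H qu       ∎
        1+v+L≤H : (1# + v) + L pu ≤ H qu
        1+v+L≤H = begin
          (1# + v) + L pu   ≡⟨ xy∙z≈y∙xz 1# v (L pu) ⟩
          v + (1# + L pu)   ≡⟨ cong (v +_) (H≡1+L pu) ⟨
          v + H pu          ≡⟨ x-y+y≡x (H qu) (H pu) ⟩
          H qu              ∎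
        1+v≤1 : 1# + v ≤ 1#
        1+v≤1 = begin
          1# + v
            ≡⟨ cong₂ _+_ (sumList-pointMass-∈ 1# (⋖⇒unique-pair p⋖q) (ListAny.here refl))
                         (sumList-pointMass-∈ v (⋖⇒unique-pair p⋖q) (ListAny.there (ListAny.here refl))) ⟨
          sumList F (pointMass p 1#) (p ∷ q ∷ []) + sumList F (pointMass q v) (p ∷ q ∷ [])
            ≡⟨ sumList-+ (pointMass p 1#) (pointMass q v) (p ∷ q ∷ []) ⟨
          sumList F (λ i → pointMass p 1# i + pointMass q v i) (p ∷ q ∷ [])
            ≤⟨ chain-bound (twoPoint∈𝒞 pu qu 0≤1 0≤v (1+L≤H pu) v+L≤H 1+v+L≤H) (⋖⇒unique-pair p⋖q) (cover-covered p⋖q pu qu) ⟩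
          1# ∎

      H-antitone : c ⊑ d → (cu : c ∉ marked) (du : d ∉ marked) → H du ≤ H cu
      H-antitone ε                  cu du = H-min du target-marked (satChain-≼ (proj₂ route))
        where open Ascent (proj₁ (highest cu))
      H-antitone ((c⋖e , eu) ◅ e⊑d) cu du = ≤-trans (H-antitone e⊑d eu du) (H-antitone-⋖ c⋖e cu eu)

      chain-ascent : IsChain (c ∷ cs) → (cu : c ∉ marked) →
                     Σ (Ascent c) λ υ → cs ⊆ₗ Ascent.steps υ × lab (Ascent.target υ) ≤ H cu
      chain-ascent [ _ ]ᶜ cu = proj₁ (highest cu) , []⊆-universal _ , ≤-refl
      chain-ascent (cons _ (c⊑d , c≢d) d∷ds) cu with chain-ascent d∷ds (chain-head-unmarked d∷ds)
      ... | ascent t tm qs d⇝t , ds⊆qs , t≤Hd with prepend c⊑d d⇝t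
      ...   | qs′ , c⇝t , d∷qs⊆c∷qs′ =
        ascent t tm qs′ c⇝t ,
        Equivalence.from (∷ʳ⁻¹ (c≢d ∘ sym)) (⊆-trans (refl ∷ ds⊆qs) d∷qs⊆c∷qs′) ,
        ≤-trans t≤Hd (H-antitone c⊑d cu (chain-head-unmarked d∷ds))

      chain-covered : IsChain (c ∷ cs) → Covered (c ∷ cs)
      chain-covered {c} {cs} chain with ∃-k·t≤1<[1+k]·t (length cs)
      ... | t , 0≤t , k·t≤1 , [1+k]·t≰1 = decidable-stable (covered? (c ∷ cs)) λ uncovered →
        [1+k]·t≰1 (+-cancelʳ-≤ (L cu) (begin
          suc (length cs) · t + L cu
            ≤⟨ uncovered-gap uncovered (chain-unique chain) refl 0≤t k·t≤1 source-marked
                 (Ascent.target-marked (proj₁ υ)) (route-++ route cu (Ascent.route (proj₁ υ)))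
                 (++⁺ˡ steps (refl ∷ proj₁ (proj₂ υ))) ⟩
          lab (Ascent.target (proj₁ υ))  ≤⟨ proj₂ (proj₂ υ) ⟩
          H cu                           ≡⟨ H≡1+L cu ⟩
          1# + L cu                      ∎))
        where
        cu = chain-head-unmarked chain
        open Descent (proj₁ (lowest cu)) using (source-marked; steps; route)
        υ = chain-ascent chain cu

    ¬¬-decidable : ¬ ¬ Decidable₂ _≼_
    ¬¬-decidable = sequence ¬¬-applicative (λ i → sequence ¬¬-applicative (λ j → ¬¬-excluded-middle))
      where ¬¬-applicative = RawMonad.rawApplicative ¬¬-Monad

    chain-covered : MinMaxMarked → Regular → IsChain (c ∷ cs) → Covered (c ∷ cs)
    chain-covered minMax regular chain =
      decidable-stable (covered? _) (¬¬-map (λ _≼?_ → WithDecidableOrder.chain-covered minMax regular _≼?_ chain) ¬¬-decidable)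

    𝒞⊆chainPolytope : MinMaxMarked → Regular → 𝒞 x → InChainPolytope x
    𝒞⊆chainPolytope {x} minMax regular x∈𝒞 = proj₁ x∈𝒞 , bound
      where
      bound : ∀ cs → IsChain cs → sumList F x cs ≤ 1#
      bound []       _     = 0≤1
      bound (c ∷ cs) chain = chain-bound x∈𝒞 (chain-unique chain) (chain-covered minMax regular chain)

    chainPolytope⊆𝒞 : InChainPolytope x → 𝒞 x
    chainPolytope⊆𝒞 {x} (0≤x , chain≤1) = 0≤x , bound
      where
      bound : ∀ a ps b → a ∈ marked → b ∈ marked → All (_∉ marked) ps → SatChain a ps b →
              sumList F x ps ≤ lab b - lab a
      bound a []       b am bm _         s = x≤y⇒0≤y-x (λ-monotone am bm (satChain-≼ s))
      bound a (p ∷ ps) b am bm unmarked s =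
        ≤-trans (chain≤1 (p ∷ ps) (route⇒chain (unmarked , s))) (x+y≤z⇒x≤z-y (route-gap am bm (unmarked , s) (ListAny.here refl)))

lemma4p1 : (F : OrderedField) (M : MarkedPoset F) →
    MarkedPoset.MinMaxMarked M →
    MarkedPoset.Strict M →
    MarkedPoset.Regular M →
    DescribedBy01 F M →
    Σ (PosetOnUnmarked F M) λ Q →
      ∀ x → (InMarkedChainPolytope F M x → PosetOnUnmarked.InChainPolytope Q x) ×
            (PosetOnUnmarked.InChainPolytope Q x → InMarkedChainPolytope F M x)
lemma4p1 F M minMax _ regular (J , 𝓘 , _ , 𝓘-unmarked , describes) =
  Q , λ x → 𝒞⊆chainPolytope minMax regular , chainPolytope⊆𝒞
  where
  open MarkedPosetProperties F M
  open WithDescription J 𝓘 𝓘-unmarked describes
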